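{- Let $(H,\omega)$ be an edge-weighted graph with positive integer weights and let $(G,\mathcal S)=(G(H,\omega),\mathcal S(H,\omega))$. Let $(A,B)$ be an $\mathcal S$-cut of $G$ and let $M=\{a_1b_1,\dots,a_tb_t\}$ ($a_i\in A$, $b_i\in B$) be a semi-induced matching of $G$ between $A$ and $B$ consisting only of dummy edges, such that all the vertices $a_1,\dots,a_t$ lie in the same part of $\mathcal S$. Then $t\le 6$.
   Context: Construction of $(G(H,\omega),\mathcal S(H,\omega))$: for each ordered pair $(u,v)$ with $uv\in E(H)$, add an independent set $I(u,v)$ of $\omega(uv)$ new vertices; let $S(u)=\bigcup_{v\in N_H(u)}I(u,v)$ and $\mathcal S=\{S(u):u\in V(H)\}$. Dummy edges: for every two edges $uv,xy$ of $H$ sharing no endpoint, every vertex of $I(u,v)$ is joined to every vertex of $I(x,y)$ (for all orientations). Matching edges: for every $uv\in E(H)$, a perfect matching between $I(u,v)$ and $I(v,u)$. These are all the edges of $G$. An $\mathcal S$-cut is a bipartition $(A,B)$ of $V(G)$ such that each part of $\mathcal S$ lies in $A$ or in $B$. A semi-induced matching between $A$ and $B$ is a matching whose edges go between $A$ and $B$ and which is an induced matching of the bipartite graph formed by the edges of $G$ between $A$ and $B$. -}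

module Defs where

open import Data.Nat using (ℕ; _≤_; _<_)
open import Data.Fin using (Fin; toℕ)
open import Data.Bool using (Bool; true; false; T)
open import Data.Product using (Σ; _×_; _,_)
open import Data.Sum using (_⊎_)
open import Relation.Nullary using (¬_)
open import Relation.Binary.PropositionalEquality using (_≡_; _≢_)

-- A finite simple graph H on vertex set Fin n (adjacency given as a
-- Boolean matrix), with positive integer edge weights ω and, for every
-- edge uv, a chosen perfect matching between I(u,v) and I(v,u),
-- encoded as mutually inverse bijections π u v : I(u,v) → I(v,u).
record WGraph (n : ℕ) : Set where
  field
    adj     : Fin n → Fin n → Bool
    irrefl  : ∀ u → adj u u ≡ false
    sym     : ∀ u v → adj u v ≡ adj v u
    ω       : Fin n → Fin n → ℕ
    ω-sym   : ∀ u v → ω u v ≡ ω v u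
    ω-pos   : ∀ u v → T (adj u v) → 1 ≤ ω u v
    π       : ∀ u v → T (adj u v) → Fin (ω u v) → Fin (ω v u)
    π-inv   : ∀ u v (e : T (adj u v)) (e' : T (adj v u)) (i : Fin (ω u v)) →
              π v u e' (π u v e i) ≡ i

module _ {n : ℕ} (H : WGraph n) where
  open WGraph H

  -- vertices of G(H,ω): the element i of I(u,v), for an edge uv of H
  record GV : Set where
    constructor gv
    field
      u : Fin n
      v : Fin n
      e : T (adj u v)
      i : Fin (ω u v)
  open GV public

  -- S(w) = ⋃_{v ∈ N(w)} I(w,v) : x ∈ S(w) iff u x ≡ w
  InS : Fin n → GV → Set
  InS w x = u x ≡ w

  Dummy : GV → GV → Set
  Dummy x y = (u x ≢ u y) × (u x ≢ v y) × (v x ≢ u y) × (v x ≢ v y)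

  MatchE : GV → GV → Set
  MatchE x y = (u y ≡ v x) × (v y ≡ u x) ×
               (toℕ (i y) ≡ toℕ (π (u x) (v x) (e x) (i x)))

  GEdge : GV → GV → Set
  GEdge x y = Dummy x y ⊎ MatchE x y

  -- a bipartition (A,B) of V(G): A = {x | side x ≡ true}, B = the rest;
  -- it is an S-cut if every part S(w) lies entirely in A or in B
  IsSCut : (GV → Bool) → Set
  IsSCut side = ∀ w x y → InS w x → InS w y → side x ≡ side y

  IsSemiInducedDummyMatching : (side : GV → Bool) (t : ℕ) →
                               (Fin t → GV) → (Fin t → GV) → Set
  IsSemiInducedDummyMatching side t a b =
    (∀ k → side (a k) ≡ true) ×
    (∀ k → side (b k) ≡ false) ×
    (∀ k l → a k ≡ a l → k ≡ l) ×
    (∀ k l → b k ≡ b l → k ≡ l) ×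
    (∀ k → Dummy (a k) (b k)) ×
    (∀ k l → k ≢ l → ¬ GEdge (a k) (b l))

{-# OPTIONS --safe #-}
module Submission where

open import Defs
open import Data.Nat using (ℕ; _≤_; zero; suc; z≤n; s≤s)
open import Data.Nat.Properties using (≤-trans; ≮⇒≥)
open import Data.Fin using (Fin; _≟_)
import Data.Fin as Fin
open import Data.Fin.Properties using (pigeonhole; <⇒≢; suc-injective)
open import Data.Bool using (Bool)
open import Data.Product using (Σ; _,_)
open import Data.Sum using (_⊎_; inj₁; inj₂; [_,_])
open import Function using (_∘_)
open import Relation.Nullary using (¬_; Dec; yes; no; contradiction)
open import Relation.Nullary.Decidable using (_⊎-dec_; decidable-stable)
open import Relation.Binary.PropositionalEquality
  using (_≡_; sym; trans; subst; _≢_)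

-- Let every a_k lie in S(w), so a_k sits on the edge w v(a_k) of H. For
-- k ≠ l the pair a_k b_l is not a dummy edge, and w is not on the edge of
-- b_l (as a_l b_l is dummy), so v(a_k) is an endpoint of the edge of b_l.
-- The tips v(a_k) are pairwise distinct, since a_k with the same edge as a_l
-- would be dummy-adjacent to b_l. Hence the t - 1 tips v(a_k), k ≠ l, lie
-- injectively in a two-element set: t ≤ 3.

injective-into-pair : ∀ {m} {A : Set} {x y : A} (f : Fin m → A) →
                      (∀ {i j} → f i ≡ f j → i ≡ j) →
                      (∀ j → f j ≡ x ⊎ f j ≡ y) → m ≤ 2
injective-into-pair {x = x} {y} f f-injective covered = ≮⇒≥ λ 2<m →
  let i , j , i<j , same-tag = pigeonhole 2<m (tag ∘ covered) in
  <⇒≢ i<j (f-injective (same-tag⇒same (covered i) (covered j) same-tag))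
  where
  tag : ∀ {z} → z ≡ x ⊎ z ≡ y → Fin 2
  tag (inj₁ _) = Fin.zero
  tag (inj₂ _) = Fin.suc Fin.zero

  same-tag⇒same : ∀ {z z'} (p : z ≡ x ⊎ z ≡ y) (q : z' ≡ x ⊎ z' ≡ y) →
                  tag p ≡ tag q → z ≡ z'
  same-tag⇒same (inj₁ p) (inj₁ q) _ = trans p (sym q)
  same-tag⇒same (inj₂ p) (inj₂ q) _ = trans p (sym q)
  same-tag⇒same (inj₁ _) (inj₂ _) ()
  same-tag⇒same (inj₂ _) (inj₁ _) ()

module _ {n : ℕ} {H : WGraph n} where

  OnEdge : Fin n → GV H → Set
  OnEdge z y = z ≡ u y ⊎ z ≡ v y

  on-edge? : ∀ z y → Dec (OnEdge z y)
  on-edge? z y = (z ≟ u y) ⊎-dec (z ≟ v y)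

  dummy-avoids-u : ∀ x y → Dummy H x y → ¬ OnEdge (u x) y
  dummy-avoids-u _ _ (u≢u , u≢v , _ , _) = [ u≢u , u≢v ]

  dummy-avoids-v : ∀ x y → Dummy H x y → ¬ OnEdge (v x) y
  dummy-avoids-v _ _ (_ , _ , v≢u , v≢v) = [ v≢u , v≢v ]

  dummy-from-same-part : ∀ x x' y → u x ≡ u x' → Dummy H x' y →
                         ¬ OnEdge (v x) y → Dummy H x y
  dummy-from-same-part x x' y ux≡ux' d' v∉y =
    ( u∉y ∘ inj₁ , u∉y ∘ inj₂ , v∉y ∘ inj₁ , v∉y ∘ inj₂ )
    where
    u∉y : ¬ OnEdge (u x) y
    u∉y = dummy-avoids-u x' y d' ∘ subst (λ z → OnEdge z y) ux≡ux'

  non-dummy-on-edge : ∀ x x' y → u x ≡ u x' → Dummy H x' y →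
                      ¬ Dummy H x y → OnEdge (v x) y
  non-dummy-on-edge x x' y ux≡ux' d' ¬d =
    decidable-stable (on-edge? (v x) y) (¬d ∘ dummy-from-same-part x x' y ux≡ux' d')

module StarDummyMatching {n : ℕ} (H : WGraph n) (side : GV H → Bool)
  (t : ℕ) (a b : Fin t → GV H) (M : IsSemiInducedDummyMatching H side t a b)
  (w : Fin n) (a∈S : ∀ k → InS H w (a k)) where

  private
    dummy : ∀ k → Dummy H (a k) (b k)
    dummy = let (_ , _ , _ , _ , d , _) = M in d

    induced : ∀ k l → k ≢ l → ¬ Dummy H (a k) (b l)
    induced k l k≢l = let (_ , _ , _ , _ , _ , ind) = M in ind k l k≢l ∘ inj₁

    same-part : ∀ k l → u (a k) ≡ u (a l)
    same-part k l = trans (a∈S k) (sym (a∈S l))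

  tip-on-edge : ∀ k l → k ≢ l → OnEdge (v (a k)) (b l)
  tip-on-edge k l k≢l =
    non-dummy-on-edge (a k) (a l) (b l) (same-part k l) (dummy l) (induced k l k≢l)

  tips-injective : ∀ {k l} → v (a k) ≡ v (a l) → k ≡ l
  tips-injective {k} {l} same-tip with k ≟ l
  ... | yes k≡l = k≡l
  ... | no k≢l = contradiction
    (dummy-from-same-part (a k) (a l) (b l) (same-part k l) (dummy l)
      (dummy-avoids-v (a l) (b l) (dummy l) ∘ subst (λ z → OnEdge z (b l)) same-tip))
    (induced k l k≢l)

star-dummy-matching-size≤3 : ∀ {n} (H : WGraph n) (side : GV H → Bool) (t : ℕ)
  (a b : Fin t → GV H) → IsSemiInducedDummyMatching H side t a b →
  (w : Fin n) → (∀ k → InS H w (a k)) → t ≤ 3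
star-dummy-matching-size≤3 H side zero a b M w a∈S = z≤n
star-dummy-matching-size≤3 H side (suc m) a b M w a∈S =
  s≤s (injective-into-pair (v ∘ a ∘ Fin.suc) (suc-injective ∘ tips-injective)
         (λ j → tip-on-edge (Fin.suc j) Fin.zero λ ()))
  where open StarDummyMatching H side (suc m) a b M w a∈S

lemma20 : ∀ {n} (H : WGraph n) (side : GV H → Bool) → IsSCut H side →
          (t : ℕ) (a b : Fin t → GV H) →
          IsSemiInducedDummyMatching H side t a b →
          Σ (Fin n) (λ w → ∀ k → InS H w (a k)) →
          t ≤ 6
lemma20 H side _ t a b M (w , a∈S) =
  ≤-trans (star-dummy-matching-size≤3 H side t a b M w a∈S) (s≤s (s≤s (s≤s z≤n)))
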